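{- Let $D=(V,A)$ be a digraph and $\mathcal{L}\subseteq 2^V$ a laminar family with $V\in\mathcal{L}$ and $\{v\}\in\mathcal{L}$ for every $v\in V$. Let $R=\{r\in V:$ there exists an $\mathcal{L}$-tight arborescence in $D$ with root $r\}$. Then $f_{D,\mathcal{L}}(R)=0$.
   Context: A (spanning) arborescence of $D$ is an arc set which is a spanning tree in the undirected sense in which every node has in-degree at most one; the node of in-degree $0$ is its root. $B$ is $\mathcal{L}$-tight if $|\delta^{in}_B(F)|\le 1$ for all $F\in\mathcal{L}$ and $|\delta^{in}_B(F)|=0$ for all $F\in\mathcal{L}$ containing the root of $B$. For $Z\subseteq V$, $\mathcal{L}_Z=\{F\in\mathcal{L}:F\cap Z\ne\emptyset\}$, $M_{D,\mathcal{L}}(Z)=\delta^{in}_D(Z)\setminus\bigcup_{F\in\mathcal{L}_Z}\delta^{out}_D(F)$ and $f_{D,\mathcal{L}}(Z)=|M_{D,\mathcal{L}}(Z)|$. -}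

module Defs where

open import Data.Nat using (ℕ; _≤_)
open import Data.Bool using (Bool; true; false; not; _∧_; _∨_)
open import Data.Fin using (Fin)
open import Data.Fin.Subset using (Subset; _∈_; _∉_; _⊆_; _∩_; ⊤; ⁅_⁆; ∣_∣; Nonempty; Empty)
open import Data.Fin.Subset.Properties using (nonempty?)
open import Data.Vec using (lookup; tabulate)
open import Data.List using (List; []; _∷_)
open import Data.List.Relation.Unary.Unique.Propositional using (Unique)
import Data.List.Membership.Propositional as LM
open import Data.Product using (Σ; ∃; _×_)
open import Data.Sum using (_⊎_)
open import Relation.Nullary using (¬_; does)
open import Relation.Binary.PropositionalEquality using (_≡_)

-- A digraph D = (V, A) with V = Fin n and A = Fin m (parallel arcs and
-- loops allowed); arc a goes from  tl a  to  hd a.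
record Digraph : Set where
  field
    n  : ℕ
    m  : ℕ
    tl : Fin m → Fin n
    hd : Fin m → Fin n
open Digraph public

Family : Digraph → Set
Family D = List (Subset (n D))

Laminar : (D : Digraph) → Family D → Set
Laminar D L = ∀ {F G} → F LM.∈ L → G LM.∈ L →
  F ⊆ G ⊎ G ⊆ F ⊎ Empty (F ∩ G)

_∈ᵇ_ : ∀ {k} → Fin k → Subset k → Bool
x ∈ᵇ S = lookup S x

δin : (D : Digraph) → Subset (m D) → Subset (n D) → Subset (m D)
δin D B F = tabulate λ a → (a ∈ᵇ B) ∧ (hd D a ∈ᵇ F) ∧ not (tl D a ∈ᵇ F)

δout : (D : Digraph) → Subset (n D) → Subset (m D)
δout D F = tabulate λ a → (tl D a ∈ᵇ F) ∧ not (hd D a ∈ᵇ F)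

allArcs : (D : Digraph) → Subset (m D)
allArcs D = ⊤

leavesSomeLZ : (D : Digraph) → Family D → Subset (n D) → Fin (m D) → Bool
leavesSomeLZ D [] Z a = false
leavesSomeLZ D (F ∷ L) Z a =
  (does (nonempty? (F ∩ Z)) ∧ (a ∈ᵇ δout D F)) ∨ leavesSomeLZ D L Z a

M : (D : Digraph) → Family D → Subset (n D) → Subset (m D)
M D L Z = tabulate λ a → (a ∈ᵇ δin D (allArcs D) Z) ∧ not (leavesSomeLZ D L Z a)

f : (D : Digraph) → Family D → Subset (n D) → ℕ
f D L Z = ∣ M D L Z ∣

data Connects (D : Digraph) (B : Subset (m D)) : Fin (n D) → List (Fin (m D)) → Fin (n D) → Set where
  stay : ∀ {u} → Connects D B u [] u
  fwd  : ∀ {u v a as} → a ∈ B → tl D a ≡ u → Connects D B (hd D a) as v → Connects D B u (a ∷ as) v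
  bwd  : ∀ {u v a as} → a ∈ B → hd D a ≡ u → Connects D B (tl D a) as v → Connects D B u (a ∷ as) v

Connected : (D : Digraph) → Subset (m D) → Set
Connected D B = ∀ u v → ∃ λ as → Connects D B u as v

Acyclic : (D : Digraph) → Subset (m D) → Set
Acyclic D B = ∀ u as → Connects D B u as u → Unique as → as ≡ []

SpanningTree : (D : Digraph) → Subset (m D) → Set
SpanningTree D B = Connected D B × Acyclic D B

indeg : (D : Digraph) → Subset (m D) → Fin (n D) → ℕ
indeg D B v = ∣ δin D B ⁅ v ⁆ ∣

Arborescence : (D : Digraph) → Subset (m D) → Fin (n D) → Set
Arborescence D B r = SpanningTree D B × (∀ v → indeg D B v ≤ 1) × indeg D B r ≡ 0

Tight : (D : Digraph) → Family D → Subset (m D) → Fin (n D) → Set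
Tight D L B r = (∀ {F} → F LM.∈ L → ∣ δin D B F ∣ ≤ 1)
              × (∀ {F} → F LM.∈ L → r ∈ F → ∣ δin D B F ∣ ≡ 0)

HasTightArb : (D : Digraph) → Family D → Fin (n D) → Set
HasTightArb D L r = Σ (Subset (m D)) λ B → Arborescence D B r × Tight D L B r

module Submission where

-- Suppose an arc a = uw lies in M(R), so w ∈ R, u ∉ R and a leaves no member of L meeting R.
-- Members of L containing u form a chain (laminarity), so there is a greatest F ∈ L with
-- u ∈ F and w ∉ F ({u} is a candidate).  Let B be an L-tight arborescence rooted at w; its
-- w–u path enters F through an arc e, the only arc of B entering F.  Replacing e by a gives
-- an L-tight arborescence rooted at the head of e, which lies in F.  Hence F meets R, and a
-- leaves F: a contradiction.

open import Data.Bool using (Bool; true; false; not; _∧_)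
open import Data.Bool.Properties using (∨-zeroʳ)
open import Data.Empty using (⊥; ⊥-elim)
open import Data.Fin using (Fin; zero; suc) renaming (_≟_ to _≟ᶠ_)
open import Data.Fin.Subset using (Subset; _∈_; _∉_; _⊆_; _∩_; _∪_; _-_; ⊤; ⁅_⁆; ∣_∣; Nonempty; Empty)
open import Data.Fin.Subset.Properties
  using (x∈⁅x⁆; x∈⁅y⁆⇒x≡y; ∣⁅x⁆∣≡1; ∣⊥∣≡0; Empty-unique; p⊆q⇒∣p∣≤∣q∣; x∈p∧x≢y⇒x∈p-y;
         x∈p⇒∣p-x∣<∣p∣; x≢y⇒x∉⁅y⁆; nonempty?; _∈?_; ⊆-refl; ⊆-trans; x∈p∩q⁺;
         x∈p∪q⁻; x∈p∪q⁺; p─q⊆p)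
open import Data.List using (List; []; _∷_; _++_)
open import Data.List.Membership.Propositional using () renaming (_∈_ to _∈ₗ_)
open import Data.List.Relation.Unary.All using (All; []; _∷_)
open import Data.List.Relation.Unary.Any using (here; there)
open import Data.List.Relation.Unary.Unique.Propositional using (Unique; []; _∷_)
open import Data.Nat using (ℕ; suc; _≤_; _+_; z≤n)
open import Data.Nat.Properties using (≤-refl; ≤-trans; ≤-reflexive; <-≤-trans; n<1⇒n≡0; 1+n≰n; n≤1+n)
open import Data.Product using (∃; _×_; _,_; proj₁; proj₂)
open import Data.Vec using (_∷_; there; lookup; tabulate)
open import Data.Vec.Properties using ([]=⇒lookup; lookup⇒[]=; lookup∘tabulate)
open import Function using (_∘_)
open import Relation.Nullary using (¬_; yes; no)
open import Relation.Binary.PropositionalEquality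
open import Relation.Nullary.Decidable using (_×-dec_; ¬?; dec-true)
open import Relation.Unary using (Pred; Decidable)
open import Level using (0ℓ)
open import Data.Sum using (_⊎_; inj₁; inj₂)

open import Defs

private
  variable
    k : ℕ
    p : Subset k
    x y : Fin k

x∈p⇒⁅x⁆⊆p : x ∈ p → ⁅ x ⁆ ⊆ p
x∈p⇒⁅x⁆⊆p {x = x} x∈p y∈⁅x⁆ = subst (_∈ _) (sym (x∈⁅y⁆⇒x≡y x y∈⁅x⁆)) x∈p

x∈p⇒∣p∣≢0 : x ∈ p → ∣ p ∣ ≢ 0
x∈p⇒∣p∣≢0 {x = x} x∈p ∣p∣≡0 with subst₂ _≤_ (∣⁅x⁆∣≡1 x) ∣p∣≡0 (p⊆q⇒∣p∣≤∣q∣ (x∈p⇒⁅x⁆⊆p x∈p))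
... | ()

Empty⇒∣p∣≡0 : Empty p → ∣ p ∣ ≡ 0
Empty⇒∣p∣≡0 {k} p-empty = trans (cong ∣_∣ (Empty-unique p-empty)) (∣⊥∣≡0 k)

∣p∣≤1⇒x≡y : ∣ p ∣ ≤ 1 → x ∈ p → y ∈ p → x ≡ y
∣p∣≤1⇒x≡y {x = x} {y = y} ∣p∣≤1 x∈p y∈p with x ≟ᶠ y
... | yes x≡y = x≡y
... | no x≢y = ⊥-elim (x∈p⇒∣p∣≢0 (x∈p∧x≢y⇒x∈p-y y∈p (x≢y ∘ sym))
                                 (n<1⇒n≡0 (<-≤-trans (x∈p⇒∣p-x∣<∣p∣ x∈p) ∣p∣≤1)))

x≡y⇒∣p∣≤1 : (∀ {x y} → x ∈ p → y ∈ p → x ≡ y) → ∣ p ∣ ≤ 1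
x≡y⇒∣p∣≤1 {p = p} all-equal with nonempty? p
... | no p-empty = subst (_≤ 1) (sym (Empty⇒∣p∣≡0 p-empty)) z≤n
... | yes (x , x∈p) = subst (∣ p ∣ ≤_) (∣⁅x⁆∣≡1 x) (p⊆q⇒∣p∣≤∣q∣ p⊆⁅x⁆)
  where
  p⊆⁅x⁆ : p ⊆ ⁅ x ⁆
  p⊆⁅x⁆ y∈p = subst (_∈ ⁅ x ⁆) (all-equal x∈p y∈p) (x∈⁅x⁆ x)

x∉p-x : x ∉ p - x
x∉p-x {x = zero} {p = _ ∷ _} ()
x∉p-x {x = suc x} {p = _ ∷ _} (there x∈p-x) = x∉p-x x∈p-x

∈-tabulate⁻ : ∀ {g : Fin k → Bool} → x ∈ tabulate g → g x ≡ true
∈-tabulate⁻ {x = x} {g = g} x∈ = trans (sym (lookup∘tabulate g x)) ([]=⇒lookup x∈)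

∈-tabulate⁺ : ∀ {g : Fin k → Bool} → g x ≡ true → x ∈ tabulate g
∈-tabulate⁺ {x = x} {g = g} gx≡true = lookup⇒[]= x _ (trans (lookup∘tabulate g x) gx≡true)

x∉p⇒lookup≡false : x ∉ p → lookup p x ≡ false
x∉p⇒lookup≡false {x = x} {p = p} x∉p with lookup p x in eq
... | false = refl
... | true = ⊥-elim (x∉p (lookup⇒[]= x p eq))

lookup≡false⇒x∉p : lookup p x ≡ false → x ∉ p
lookup≡false⇒x∉p px≡false x∈p with trans (sym ([]=⇒lookup x∈p)) px≡false
... | ()

module Arcs (D : Digraph) where

  Enters : Subset (m D) → Subset (n D) → Fin (m D) → Set
  Enters B F c = c ∈ B × hd D c ∈ F × tl D c ∉ F

  δin⁻ : ∀ {B F c} → c ∈ δin D B F → Enters B F c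
  δin⁻ {B} {F} {c} c∈δin with lookup B c in c∈B | lookup F (hd D c) in h∈F | lookup F (tl D c) in t∉F
                            | ∈-tabulate⁻ c∈δin
  ... | true | true | false | _ = lookup⇒[]= c B c∈B , lookup⇒[]= (hd D c) F h∈F , lookup≡false⇒x∉p t∉F
  ... | true | true | true | ()
  ... | true | false | _ | ()
  ... | false | _ | _ | ()

  δin⁺ : ∀ {B F c} → Enters B F c → c ∈ δin D B F
  δin⁺ {B} {F} {c} (c∈B , h∈F , t∉F) = ∈-tabulate⁺ enters
    where
    enters : lookup B c ∧ lookup F (hd D c) ∧ not (lookup F (tl D c)) ≡ true
    enters rewrite []=⇒lookup c∈B | []=⇒lookup h∈F | x∉p⇒lookup≡false t∉F = refl

  δout⁺ : ∀ {F c} → tl D c ∈ F → hd D c ∉ F → c ∈ δout D F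
  δout⁺ {F} {c} tc∈F hc∉F = ∈-tabulate⁺ leaves
    where
    leaves : lookup F (tl D c) ∧ not (lookup F (hd D c)) ≡ true
    leaves rewrite []=⇒lookup tc∈F | x∉p⇒lookup≡false hc∉F = refl

  leavesSomeLZ⁺ : ∀ {L Z F c} → F ∈ₗ L → Nonempty (F ∩ Z) → c ∈ δout D F → leavesSomeLZ D L Z c ≡ true
  leavesSomeLZ⁺ {Z = Z} {F} (here refl) F∩Z≢∅ c∈δout
    rewrite dec-true (nonempty? (F ∩ Z)) F∩Z≢∅ | []=⇒lookup c∈δout = refl
  leavesSomeLZ⁺ (there F∈L) F∩Z≢∅ c∈δout rewrite leavesSomeLZ⁺ F∈L F∩Z≢∅ c∈δout = ∨-zeroʳ _

  M⁻ : ∀ {L Z c} → c ∈ M D L Z → Enters ⊤ Z c × leavesSomeLZ D L Z c ≡ false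
  M⁻ {L} {Z} {c} c∈M with lookup (δin D ⊤ Z) c in c∈δin | leavesSomeLZ D L Z c | ∈-tabulate⁻ c∈M
  ... | true | false | _ = δin⁻ (lookup⇒[]= c _ c∈δin) , refl
  ... | true | true | ()
  ... | false | _ | ()

  module _ {B : Subset (m D)} {F : Subset (n D)} where

    ∣δin∣≡0⇒¬Enters : ∣ δin D B F ∣ ≡ 0 → ∀ {c} → ¬ Enters B F c
    ∣δin∣≡0⇒¬Enters ∣δin∣≡0 c-enters = x∈p⇒∣p∣≢0 (δin⁺ c-enters) ∣δin∣≡0

    ¬Enters⇒∣δin∣≡0 : (∀ {c} → ¬ Enters B F c) → ∣ δin D B F ∣ ≡ 0
    ¬Enters⇒∣δin∣≡0 none-enters = Empty⇒∣p∣≡0 λ (_ , c∈δin) → none-enters (δin⁻ c∈δin)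

    ∣δin∣≤1⇒Enters-unique : ∣ δin D B F ∣ ≤ 1 → ∀ {c d} → Enters B F c → Enters B F d → c ≡ d
    ∣δin∣≤1⇒Enters-unique ∣δin∣≤1 c-enters d-enters =
      ∣p∣≤1⇒x≡y ∣δin∣≤1 (δin⁺ c-enters) (δin⁺ d-enters)

    Enters-unique⇒∣δin∣≤1 : (∀ {c d} → Enters B F c → Enters B F d → c ≡ d) → ∣ δin D B F ∣ ≤ 1
    Enters-unique⇒∣δin∣≤1 enters-unique =
      x≡y⇒∣p∣≤1 λ c∈δin d∈δin → enters-unique (δin⁻ c∈δin) (δin⁻ d∈δin)

  HeadInjective : Subset (m D) → Set
  HeadInjective B = ∀ {c d} → c ∈ B → d ∈ B → hd D c ≡ hd D d → c ≡ d

  Unentered : Subset (m D) → Fin (n D) → Set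
  Unentered B r = ∀ {c} → c ∈ B → hd D c ≢ r

  module _ {B : Subset (m D)} where

    Acyclic⇒loopless : Acyclic D B → ∀ {c} → c ∈ B → tl D c ≢ hd D c
    Acyclic⇒loopless acyclic {c} c∈B tl≡hd
      with acyclic (tl D c) (c ∷ []) (fwd c∈B refl (subst (Connects D B (hd D c) []) (sym tl≡hd) stay))
                   ([] ∷ [])
    ... | ()

    Acyclic⇒Enters-head : Acyclic D B → ∀ {c} → c ∈ B → Enters B ⁅ hd D c ⁆ c
    Acyclic⇒Enters-head acyclic c∈B = c∈B , x∈⁅x⁆ _ , x≢y⇒x∉⁅y⁆ (Acyclic⇒loopless acyclic c∈B)

    indeg≤1⇒HeadInjective : Acyclic D B → (∀ v → indeg D B v ≤ 1) → HeadInjective B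
    indeg≤1⇒HeadInjective acyclic indeg≤1 {c} {d} c∈B d∈B hc≡hd =
      ∣δin∣≤1⇒Enters-unique (indeg≤1 (hd D c)) (Acyclic⇒Enters-head acyclic c∈B)
        (subst (λ v → Enters B ⁅ v ⁆ d) (sym hc≡hd) (Acyclic⇒Enters-head acyclic d∈B))

    indeg≡0⇒Unentered : Acyclic D B → ∀ {r} → indeg D B r ≡ 0 → Unentered B r
    indeg≡0⇒Unentered acyclic indeg≡0 c∈B refl =
      ∣δin∣≡0⇒¬Enters indeg≡0 (Acyclic⇒Enters-head acyclic c∈B)

    HeadInjective⇒indeg≤1 : HeadInjective B → ∀ v → indeg D B v ≤ 1
    HeadInjective⇒indeg≤1 head-injective v =
      Enters-unique⇒∣δin∣≤1 λ (c∈B , hc∈⁅v⁆ , _) (d∈B , hd∈⁅v⁆ , _) →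
        head-injective c∈B d∈B (trans (x∈⁅y⁆⇒x≡y v hc∈⁅v⁆) (sym (x∈⁅y⁆⇒x≡y v hd∈⁅v⁆)))

    Unentered⇒indeg≡0 : ∀ {r} → Unentered B r → indeg D B r ≡ 0
    Unentered⇒indeg≡0 {r} r-unentered =
      ¬Enters⇒∣δin∣≡0 λ (c∈B , hc∈⁅r⁆ , _) → r-unentered c∈B (x∈⁅y⁆⇒x≡y r hc∈⁅r⁆)

  data Path (B : Subset (m D)) (r : Fin (n D)) : Fin (n D) → ℕ → Set where
    root : Path B r r 0
    step : ∀ {c v k} → c ∈ B → hd D c ≡ v → Path B r (tl D c) k → Path B r v (suc k)

  module _ {B : Subset (m D)} where

    Path-++ : ∀ {r s v k j} → Path B r s k → Path B s v j → Path B r v (j + k)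
    Path-++ r⇝s root = r⇝s
    Path-++ r⇝s (step c∈B hc≡v s⇝tc) = step c∈B hc≡v (Path-++ r⇝s s⇝tc)

    Path-enters : ∀ {F r v k} → Path B r v k → v ∈ F → r ∉ F → ∃ (Enters B F)
    Path-enters root v∈F r∉F = ⊥-elim (r∉F v∈F)
    Path-enters {F} (step {c} c∈B refl r⇝tc) hc∈F r∉F with tl D c ∈? F
    ... | yes tc∈F = Path-enters r⇝tc tc∈F r∉F
    ... | no tc∉F = c , c∈B , hc∈F , tc∉F

    Connects-++ : ∀ {s as t bs v} → Connects D B s as t → Connects D B t bs v → Connects D B s (as ++ bs) v
    Connects-++ stay t~v = t~v
    Connects-++ (fwd c∈B tc≡s hc~t) t~v = fwd c∈B tc≡s (Connects-++ hc~t t~v)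
    Connects-++ (bwd c∈B hc≡s tc~t) t~v = bwd c∈B hc≡s (Connects-++ tc~t t~v)

    Path⇒Connects-to-root : ∀ {r v k} → Path B r v k → ∃ λ as → Connects D B v as r
    Path⇒Connects-to-root root = _ , stay
    Path⇒Connects-to-root (step c∈B hc≡v r⇝tc) = _ , bwd c∈B hc≡v (proj₂ (Path⇒Connects-to-root r⇝tc))

    Path⇒Connects-from-root : ∀ {r v k} → Path B r v k → ∃ λ as → Connects D B r as v
    Path⇒Connects-from-root root = _ , stay
    Path⇒Connects-from-root (step c∈B refl r⇝tc) =
      _ , Connects-++ (proj₂ (Path⇒Connects-from-root r⇝tc)) (fwd c∈B refl stay)

    module InForest (head-injective : HeadInjective B) {r} (r-unentered : Unentered B r) where

      Path-back : ∀ {c v k} → Path B r v k → c ∈ B → hd D c ≡ v → ∃ (Path B r (tl D c))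
      Path-back root c∈B hc≡r = ⊥-elim (r-unentered c∈B hc≡r)
      Path-back (step d∈B hd≡v r⇝td) c∈B hc≡v with head-injective c∈B d∈B (trans hc≡v (sym hd≡v))
      ... | refl = _ , r⇝td

      Connects⇒Path : ∀ {s as t} → Connects D B s as t → ∃ (Path B r s) → ∃ (Path B r t)
      Connects⇒Path stay r⇝s = r⇝s
      Connects⇒Path (fwd c∈B refl hc~t) (_ , r⇝s) = Connects⇒Path hc~t (_ , step c∈B refl r⇝s)
      Connects⇒Path (bwd c∈B hc≡s tc~t) (_ , r⇝s) = Connects⇒Path tc~t (Path-back r⇝s c∈B hc≡s)

      Path-length-unique : ∀ {v k j} → Path B r v k → Path B r v j → k ≡ j
      Path-length-unique root root = refl
      Path-length-unique root (step c∈B hc≡r _) = ⊥-elim (r-unentered c∈B hc≡r)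
      Path-length-unique (step c∈B hc≡r _) root = ⊥-elim (r-unentered c∈B hc≡r)
      Path-length-unique (step c∈B hc≡v r⇝tc) (step d∈B hd≡v r⇝td)
        with head-injective c∈B d∈B (trans hc≡v (sym hd≡v))
      ... | refl = cong suc (Path-length-unique r⇝tc r⇝td)

    -- Arcs of B have distinct heads, so once a trail traverses an arc forwards it traverses every
    -- later arc forwards too: a backward arc would be a second arc into the current vertex.
    -- The height increases along forward arcs, so no trail closes up.
    module Heights (head-injective : HeadInjective B) (h : Fin (n D) → ℕ)
                   (h-step : ∀ {c} → c ∈ B → h (hd D c) ≡ suc (h (tl D c))) where

      entered-trail-end : ∀ {s as t a b} → Connects D B s as t → a ∈ B → hd D a ≡ s → All (a ≢_) as →
                          Unique as → b ∈ B → hd D b ≡ t → All (b ≢_) as → b ≡ a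
      entered-trail-end stay a∈B ha≡s _ _ b∈B hb≡s _ = head-injective b∈B a∈B (trans hb≡s (sym ha≡s))
      entered-trail-end (fwd c∈B _ hc~t) a∈B _ (_ ∷ _) (c∉as ∷ as-unique) b∈B hb≡t (b≢c ∷ b∉as) =
        ⊥-elim (b≢c (entered-trail-end hc~t c∈B refl c∉as as-unique b∈B hb≡t b∉as))
      entered-trail-end (bwd c∈B hc≡s _) a∈B ha≡s (a≢c ∷ _) _ _ _ _ =
        ⊥-elim (a≢c (head-injective a∈B c∈B (trans ha≡s (sym hc≡s))))

      entered-trail-rises : ∀ {s as t a} → Connects D B s as t → a ∈ B → hd D a ≡ s → All (a ≢_) as →
                            Unique as → h s ≤ h t
      entered-trail-rises stay _ _ _ _ = ≤-refl
      entered-trail-rises (fwd c∈B refl hc~t) _ _ _ (c∉as ∷ as-unique) =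
        ≤-trans (n≤1+n _) (≤-trans (≤-reflexive (sym (h-step c∈B)))
                                   (entered-trail-rises hc~t c∈B refl c∉as as-unique))
      entered-trail-rises (bwd c∈B hc≡s _) a∈B ha≡s (a≢c ∷ _) _ =
        ⊥-elim (a≢c (head-injective a∈B c∈B (trans ha≡s (sym hc≡s))))

      trail-to-entered-falls : ∀ {s as t b} → Connects D B s as t → Unique as → b ∈ B → hd D b ≡ t →
                               All (b ≢_) as → h t ≤ h s
      trail-to-entered-falls stay _ _ _ _ = ≤-refl
      trail-to-entered-falls (fwd c∈B _ hc~t) (c∉as ∷ as-unique) b∈B hb≡t (b≢c ∷ b∉as) =
        ⊥-elim (b≢c (entered-trail-end hc~t c∈B refl c∉as as-unique b∈B hb≡t b∉as))
      trail-to-entered-falls (bwd c∈B refl tc~t) (_ ∷ as-unique) b∈B hb≡t (_ ∷ b∉as) =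
        ≤-trans (trail-to-entered-falls tc~t as-unique b∈B hb≡t b∉as)
                (≤-trans (n≤1+n _) (≤-reflexive (sym (h-step c∈B))))

      acyclic : Acyclic D B
      acyclic _ [] _ _ = refl
      acyclic _ (_ ∷ _) (fwd {a = a} a∈B refl ha~ta) (a∉as ∷ as-unique) =
        ⊥-elim (1+n≰n (subst (_≤ h (tl D a)) (h-step a∈B)
                              (entered-trail-rises ha~ta a∈B refl a∉as as-unique)))
      acyclic _ (_ ∷ _) (bwd {a = b} b∈B refl tb~hb) (b∉as ∷ as-unique) =
        ⊥-elim (1+n≰n (subst (_≤ h (tl D b)) (h-step b∈B)
                              (trail-to-entered-falls tb~hb as-unique b∈B refl b∉as)))

  record OutTree (B : Subset (m D)) (r : Fin (n D)) : Set where
    field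
      head-injective : HeadInjective B
      root-unentered : Unentered B r
      reachable      : ∀ v → ∃ (Path B r v)

  module _ {B : Subset (m D)} {r : Fin (n D)} where

    arborescence⇒OutTree : Arborescence D B r → OutTree B r
    arborescence⇒OutTree ((connected , acyclic) , indeg≤1 , indeg≡0) = record
      { head-injective = head-injective
      ; root-unentered = root-unentered
      ; reachable      = λ v → Connects⇒Path (proj₂ (connected r v)) (0 , root)
      }
      where
      head-injective = indeg≤1⇒HeadInjective acyclic indeg≤1
      root-unentered = indeg≡0⇒Unentered acyclic indeg≡0
      open InForest head-injective root-unentered

    OutTree⇒arborescence : OutTree B r → Arborescence D B r
    OutTree⇒arborescence tree =
      (connected , Heights.acyclic head-injective depth depth-step) ,
      HeadInjective⇒indeg≤1 head-injective , Unentered⇒indeg≡0 root-unentered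
      where
      open OutTree tree
      open InForest head-injective root-unentered

      connected : Connected D B
      connected u v = _ , Connects-++ (proj₂ (Path⇒Connects-to-root (proj₂ (reachable u))))
                                      (proj₂ (Path⇒Connects-from-root (proj₂ (reachable v))))

      depth : Fin (n D) → ℕ
      depth v = proj₁ (reachable v)

      depth-step : ∀ {c} → c ∈ B → depth (hd D c) ≡ suc (depth (tl D c))
      depth-step {c} c∈B =
        Path-length-unique (proj₂ (reachable (hd D c))) (step c∈B refl (proj₂ (reachable (tl D c))))

module _ {k : ℕ} (P : Pred (Subset k) 0ℓ) where

  IsGreatest : List (Subset k) → Subset k → Set
  IsGreatest L F = F ∈ₗ L × P F × (∀ {G} → G ∈ₗ L → P G → G ⊆ F)

  IsChain : List (Subset k) → Set
  IsChain L = ∀ {F G} → F ∈ₗ L → G ∈ₗ L → P F → P G → F ⊆ G ⊎ G ⊆ F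

  chain-greatest : Decidable P → ∀ L → IsChain L → (∀ {G} → G ∈ₗ L → ¬ P G) ⊎ ∃ (IsGreatest L)
  chain-greatest P? [] _ = inj₁ λ ()
  chain-greatest P? (G ∷ L) chain
    with chain-greatest P? L (λ F∈L G∈L → chain (there F∈L) (there G∈L)) | P? G
  ... | inj₁ none | no ¬PG = inj₁ λ { (here refl) → ¬PG ; (there H∈L) → none H∈L }
  ... | inj₁ none | yes PG =
    inj₂ (G , here refl , PG , λ { (here refl) _ → ⊆-refl ; (there H∈L) PH → ⊥-elim (none H∈L PH) })
  ... | inj₂ (F , F∈L , PF , F-max) | no ¬PG =
    inj₂ (F , there F∈L , PF , λ { (here refl) PG → ⊥-elim (¬PG PG) ; (there H∈L) → F-max H∈L })
  ... | inj₂ (F , F∈L , PF , F-max) | yes PG with chain (here refl) (there F∈L) PG PF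
  ...   | inj₁ G⊆F = inj₂ (F , there F∈L , PF , λ { (here refl) _ → G⊆F ; (there H∈L) → F-max H∈L })
  ...   | inj₂ F⊆G =
    inj₂ (G , here refl , PG , λ { (here refl) _ → ⊆-refl ; (there H∈L) PH → ⊆-trans (F-max H∈L PH) F⊆G })

Separates : Fin k → Fin k → Pred (Subset k) 0ℓ
Separates u w G = u ∈ G × w ∉ G

module _ {D : Digraph} {L : Family D} (laminar : Laminar D L) where

  laminar-overlap : ∀ {F G v} → F ∈ₗ L → G ∈ₗ L → v ∈ F → v ∈ G → F ⊆ G ⊎ G ⊆ F
  laminar-overlap F∈L G∈L v∈F v∈G with laminar F∈L G∈L
  ... | inj₁ F⊆G = inj₁ F⊆G
  ... | inj₂ (inj₁ G⊆F) = inj₂ G⊆F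
  ... | inj₂ (inj₂ disjoint) = ⊥-elim (disjoint (_ , x∈p∩q⁺ (v∈F , v∈G)))

  greatest-separating : (∀ v → ⁅ v ⁆ ∈ₗ L) → ∀ {u w} → w ≢ u → ∃ (IsGreatest (Separates u w) L)
  greatest-separating singletons {u} {w} w≢u
    with chain-greatest (Separates u w) (λ G → u ∈? G ×-dec ¬? (w ∈? G)) L
           (λ F∈L G∈L (u∈F , _) (u∈G , _) → laminar-overlap F∈L G∈L u∈F u∈G)
  ... | inj₁ none = ⊥-elim (none (singletons u) (x∈⁅x⁆ u , w≢u ∘ x∈⁅y⁆⇒x≡y u))
  ... | inj₂ greatest = greatest

module Exchange {D : Digraph} {L : Family D} (laminar : Laminar D L)
                {B : Subset (m D)} {a : Fin (m D)} {F : Subset (n D)}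
                (arborescence : Arborescence D B (hd D a)) (tight : Tight D L B (hd D a))
                (F-greatest : IsGreatest (Separates (tl D a) (hd D a)) L F) where

  open Arcs D

  private
    u w : Fin (n D)
    u = tl D a
    w = hd D a

  open OutTree (arborescence⇒OutTree {r = w} arborescence)

  F∈L : F ∈ₗ L
  F∈L = proj₁ F-greatest

  u∈F : u ∈ F
  u∈F = proj₁ (proj₁ (proj₂ F-greatest))

  w∉F : w ∉ F
  w∉F = proj₂ (proj₁ (proj₂ F-greatest))

  B-entering-unique : ∀ {G c d} → G ∈ₗ L → Enters B G c → Enters B G d → c ≡ d
  B-entering-unique G∈L = ∣δin∣≤1⇒Enters-unique (proj₁ tight G∈L)

  B-root-blocks : ∀ {G c} → G ∈ₗ L → w ∈ G → ¬ Enters B G c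
  B-root-blocks G∈L w∈G = ∣δin∣≡0⇒¬Enters (proj₂ tight G∈L w∈G)

  e : Fin (m D)
  e = proj₁ (Path-enters (proj₂ (reachable u)) u∈F w∉F)

  e-enters : Enters B F e
  e-enters = proj₂ (Path-enters (proj₂ (reachable u)) u∈F w∉F)

  r′ : Fin (n D)
  r′ = hd D e

  r′∈F : r′ ∈ F
  r′∈F = proj₁ (proj₂ e-enters)

  B′ : Subset (m D)
  B′ = (B - e) ∪ ⁅ a ⁆

  ∈B′⁻ : ∀ {c} → c ∈ B′ → (c ∈ B × c ≢ e) ⊎ c ≡ a
  ∈B′⁻ c∈B′ with x∈p∪q⁻ (B - e) ⁅ a ⁆ c∈B′
  ... | inj₁ c∈B-e = inj₁ (p─q⊆p B ⁅ e ⁆ c∈B-e , λ { refl → x∉p-x c∈B-e })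
  ... | inj₂ c∈⁅a⁆ = inj₂ (x∈⁅y⁆⇒x≡y a c∈⁅a⁆)

  ∈B′⁺ : ∀ {c} → c ∈ B → c ≢ e → c ∈ B′
  ∈B′⁺ c∈B c≢e = x∈p∪q⁺ (inj₁ (x∈p∧x≢y⇒x∈p-y c∈B c≢e))

  a∈B′ : a ∈ B′
  a∈B′ = x∈p∪q⁺ (inj₂ (x∈⁅x⁆ a))

  B′-head-injective : HeadInjective B′
  B′-head-injective c∈B′ d∈B′ hc≡hd with ∈B′⁻ c∈B′ | ∈B′⁻ d∈B′
  ... | inj₁ (c∈B , _) | inj₁ (d∈B , _) = head-injective c∈B d∈B hc≡hd
  ... | inj₁ (c∈B , _) | inj₂ refl = ⊥-elim (root-unentered c∈B hc≡hd)
  ... | inj₂ refl | inj₁ (d∈B , _) = ⊥-elim (root-unentered d∈B (sym hc≡hd))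
  ... | inj₂ refl | inj₂ refl = refl

  B′-r′-unentered : Unentered B′ r′
  B′-r′-unentered c∈B′ hc≡r′ with ∈B′⁻ c∈B′
  ... | inj₁ (c∈B , c≢e) = c≢e (head-injective c∈B (proj₁ e-enters) hc≡r′)
  ... | inj₂ refl = w∉F (subst (_∈ F) (sym hc≡r′) r′∈F)

  B′-F-unentered : ∀ {c} → ¬ Enters B′ F c
  B′-F-unentered (c∈B′ , hc∈F , tc∉F) with ∈B′⁻ c∈B′
  ... | inj₁ (c∈B , c≢e) = c≢e (B-entering-unique F∈L (c∈B , hc∈F , tc∉F) e-enters)
  ... | inj₂ refl = w∉F hc∈F

  Path-split : ∀ {v k} → Path B w v k → ∃ (Path B′ w v) ⊎ ∃ (Path B′ r′ v)
  Path-split root = inj₁ (_ , root)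
  Path-split (step {c} c∈B refl w⇝tc) with c ≟ᶠ e | Path-split w⇝tc
  ... | yes refl | _ = inj₂ (_ , root)
  ... | no c≢e | inj₁ (_ , w⇝′tc) = inj₁ (_ , step (∈B′⁺ c∈B c≢e) refl w⇝′tc)
  ... | no c≢e | inj₂ (_ , r′⇝′tc) = inj₂ (_ , step (∈B′⁺ c∈B c≢e) refl r′⇝′tc)

  B′-reachable : ∀ v → ∃ (Path B′ r′ v)
  B′-reachable v with Path-split (proj₂ (reachable u))
  ... | inj₁ (_ , w⇝′u) = ⊥-elim (B′-F-unentered (proj₂ (Path-enters w⇝′u u∈F w∉F)))
  ... | inj₂ (_ , r′⇝′u) with Path-split (proj₂ (reachable v))
  ...   | inj₁ (_ , w⇝′v) = _ , Path-++ (step a∈B′ refl r′⇝′u) w⇝′v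
  ...   | inj₂ r′⇝′v = r′⇝′v

  B′-tree : OutTree B′ r′
  B′-tree = record
    { head-injective = B′-head-injective
    ; root-unentered = B′-r′-unentered
    ; reachable      = B′-reachable
    }

  overlaps-F : ∀ {G} → G ∈ₗ L → r′ ∈ G → F ⊆ G ⊎ G ⊆ F
  overlaps-F G∈L r′∈G = laminar-overlap {D = D} {L = L} laminar F∈L G∈L r′∈F r′∈G

  ¬a-enters : ∀ {G} → G ∈ₗ L → r′ ∈ G → ¬ Enters B′ G a
  ¬a-enters G∈L r′∈G (_ , w∈G , u∉G) with overlaps-F G∈L r′∈G
  ... | inj₁ F⊆G = u∉G (F⊆G u∈F)
  ... | inj₂ G⊆F = w∉F (G⊆F w∈G)

  within-F : ∀ {G} → G ∈ₗ L → r′ ∈ G → w ∉ G → G ⊆ F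
  within-F G∈L r′∈G w∉G with overlaps-F G∈L r′∈G
  ... | inj₁ F⊆G = proj₂ (proj₂ F-greatest) G∈L (F⊆G u∈F , w∉G)
  ... | inj₂ G⊆F = G⊆F

  Enters-B′⁻ : ∀ {G c} → Enters B′ G c → (Enters B G c × c ≢ e) ⊎ c ≡ a
  Enters-B′⁻ (c∈B′ , hc∈G , tc∉G) with ∈B′⁻ c∈B′
  ... | inj₁ (c∈B , c≢e) = inj₁ ((c∈B , hc∈G , tc∉G) , c≢e)
  ... | inj₂ c≡a = inj₂ c≡a

  B′-entering-unique : ∀ {G c d} → G ∈ₗ L → Enters B′ G c → Enters B′ G d → c ≡ d
  B′-entering-unique G∈L c-enters d-enters with Enters-B′⁻ c-enters | Enters-B′⁻ d-enters
  ... | inj₁ (c-enters-B , _) | inj₁ (d-enters-B , _) = B-entering-unique G∈L c-enters-B d-enters-B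
  ... | inj₁ (c-enters-B , _) | inj₂ refl = ⊥-elim (B-root-blocks G∈L (proj₁ (proj₂ d-enters)) c-enters-B)
  ... | inj₂ refl | inj₁ (d-enters-B , _) = ⊥-elim (B-root-blocks G∈L (proj₁ (proj₂ c-enters)) d-enters-B)
  ... | inj₂ refl | inj₂ refl = refl

  B′-root-blocks : ∀ {G c} → G ∈ₗ L → r′ ∈ G → ¬ Enters B′ G c
  B′-root-blocks {G} G∈L r′∈G c-enters with Enters-B′⁻ c-enters
  ... | inj₂ refl = ¬a-enters G∈L r′∈G c-enters
  ... | inj₁ (c-enters-B , c≢e) with w ∈? G
  ...   | yes w∈G = B-root-blocks G∈L w∈G c-enters-B
  ...   | no w∉G = c≢e (B-entering-unique G∈L c-enters-B e-enters-G)
    where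
    e-enters-G : Enters B G e
    e-enters-G = proj₁ e-enters , r′∈G , λ te∈G → proj₂ (proj₂ e-enters) (within-F G∈L r′∈G w∉G te∈G)

  B′-tight : Tight D L B′ r′
  B′-tight = (λ G∈L → Enters-unique⇒∣δin∣≤1 (B′-entering-unique G∈L))
           , (λ G∈L r′∈G → ¬Enters⇒∣δin∣≡0 (B′-root-blocks G∈L r′∈G))

  tight-exchange : ∃ λ r → r ∈ F × HasTightArb D L r
  tight-exchange = r′ , r′∈F , B′ , OutTree⇒arborescence B′-tree , B′-tight

claim10 : (D : Digraph) (L : Family D) → Laminar D L → ⊤ ∈ₗ L → (∀ v → ⁅ v ⁆ ∈ₗ L)
          → (R : Subset (n D)) → (∀ r → (r ∈ R → HasTightArb D L r) × (HasTightArb D L r → r ∈ R))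
          → f D L R ≡ 0
claim10 D L laminar _ singletons R R-roots = Empty⇒∣p∣≡0 λ (_ , a∈M) → M-arc-absurd a∈M
  where
  open Arcs D

  M-arc-absurd : ∀ {a} → a ∈ M D L R → ⊥
  M-arc-absurd {a} a∈M with M⁻ {L = L} a∈M
  ... | (_ , w∈R , u∉R) , not-leaving
    with greatest-separating {D = D} {L = L} laminar singletons (λ w≡u → u∉R (subst (_∈ R) w≡u w∈R))
  ... | F , F-greatest@(F∈L , (u∈F , w∉F) , _)
    with proj₁ (R-roots (hd D a)) w∈R
  ... | B , arborescence , tight
    with Exchange.tight-exchange {L = L} laminar arborescence tight F-greatest
  ... | r , r∈F , r-root with trans (sym not-leaving)
          (leavesSomeLZ⁺ {L = L} F∈L (r , x∈p∩q⁺ (r∈F , proj₂ (R-roots r) r-root)) (δout⁺ u∈F w∉F))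
  ... | ()
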